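{- Let $e=(e_1,\dots,e_n)\in{\bf I}_n(201,210)$ have parameters $(p,q)$. Then there are exactly $p+q$ integers $k$ with $(e_1,\dots,e_n,k)\in{\bf I}_{n+1}(201,210)$, and the parameters of these $p+q$ extended sequences are, as a multiset, $$(p,q+1),(p-1,q+2),\dots,(1,q+p),\ (p+1,q),\ \underbrace{(p+2,1),\dots,(p+2,1)}_{q-1}.$$
   Context: ${\bf I}_n=\{(e_1,\dots,e_n)\in\mathbb{N}^n:0\le e_i<i\}$; ${\bf I}_n(201,210)$ consists of those $e$ with no indices $i<j<k$ such that $e_j<e_k<e_i$ or $e_k<e_j<e_i$. The parameters of $e\in{\bf I}_n(201,210)$ are $(p,q)$ where $p=|\{k>e_n:(e_1,\dots,e_n,k)\in{\bf I}_{n+1}(201,210)\}|$ and $q=|\{k\le e_n:(e_1,\dots,e_n,k)\in{\bf I}_{n+1}(201,210)\}|$. -}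

module Defs where

open import Data.Nat using (ℕ; suc; _≤_; _<_; _<?_; _≤?_; _+_; _∸_)
open import Data.Nat.Properties using ()
open import Data.Fin as F using (Fin; toℕ)
open import Data.Fin.Properties using (any?; all?)
open import Data.Vec using (Vec; lookup; last; _∷ʳ_)
open import Data.List using (List; filter; length; upTo; map; replicate; _++_; _∷_)
open import Data.Product using (_×_; _,_; ∃)
open import Data.Sum using (_⊎_)
open import Relation.Nullary using (¬_; Dec)
open import Relation.Nullary.Decidable using (_×-dec_; _⊎-dec_; ¬?)

-- Inversion sequences (0-indexed): e is in I_n iff e[i] ≤ i, i.e. e_i < i 1-indexed.
IsInv : ∀ {n} → Vec ℕ n → Set
IsInv {n} e = (i : Fin n) → lookup e i ≤ toℕ i

Occ : ∀ {n} → Vec ℕ n → Fin n → Fin n → Fin n → Set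
Occ e i j k = (i F.< j) × (j F.< k) ×
  (((lookup e j < lookup e k) × (lookup e k < lookup e i)) ⊎
   ((lookup e k < lookup e j) × (lookup e j < lookup e i)))

InI : ∀ {n} → Vec ℕ n → Set
InI {n} e = IsInv e × ¬ (∃ λ i → ∃ λ j → ∃ λ k → Occ e i j k)

occ? : ∀ {n} (e : Vec ℕ n) i j k → Dec (Occ e i j k)
occ? e i j k = (i F.<? j) ×-dec (j F.<? k) ×-dec
  (((lookup e j <? lookup e k) ×-dec (lookup e k <? lookup e i)) ⊎-dec
   ((lookup e k <? lookup e j) ×-dec (lookup e j <? lookup e i)))

InI? : ∀ {n} (e : Vec ℕ n) → Dec (InI e)
InI? e = all? (λ i → lookup e i ≤? toℕ i) ×-dec
  ¬? (any? λ i → any? λ j → any? λ k → occ? e i j k)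

-- All k such that (e_1,…,e_n,k) ∈ I_{n+1}(201,210), for e of length n = suc m.
-- Any such k satisfies 0 ≤ k ≤ n, so it suffices to search the range 0..n (upTo (suc n)).
extensions : ∀ {m} → Vec ℕ (suc m) → List ℕ
extensions {m} e = filter (λ k → InI? (e ∷ʳ k)) (upTo (suc (suc m)))

paramP : ∀ {m} → Vec ℕ (suc m) → ℕ
paramP e = length (filter (λ k → last e <? k) (extensions e))

paramQ : ∀ {m} → Vec ℕ (suc m) → ℕ
paramQ e = length (filter (λ k → k ≤? last e) (extensions e))

params : ∀ {m} → Vec ℕ (suc m) → ℕ × ℕ
params e = paramP e , paramQ e

expectedParams : ℕ → ℕ → List (ℕ × ℕ)
expectedParams p q =
  map (λ i → (p ∸ i , q + suc i)) (upTo p) ++ ((suc p , q) ∷ replicate (q ∸ 1) (p + 2 , 1))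

-- Appending k to e ∈ I_n(201,210) keeps it pattern-free iff k ≤ n and, for every pair i < j with
-- e_j < e_i, either e_i ≤ k or k = e_j. By induction on n, the admissible k are then exactly
-- {x} ∪ [t, n] for some x ≤ t ≤ M = max e, where either e_n = M, or e_n = x < t = M: appending
-- k ≥ M keeps x and t, appending k < M makes k the new x and M the new t. In the first case
-- (p, q) = (n - M, [x < t] + (M - t) + 1), in the second (p, q) = (n + 1 - M, 1), and reading off
-- the parameters of each extension from these formulas gives the stated multiset.

module Submission where

open import Defs
open import Data.Empty using (⊥-elim)
open import Data.Fin as F using (Fin; toℕ; inject₁; fromℕ)
open import Data.Fin.Properties using (toℕ-inject₁; toℕ-fromℕ; toℕ<n)
open import Data.List using (List; []; _∷_; length; map; filter; upTo; applyUpTo; replicate; _++_)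
open import Data.List.Properties using (map-++; length-++; ++-assoc; filter-++; filter-accept; filter-reject; filter-all; filter-none; map-applyUpTo; map-upTo; length-applyUpTo)
open import Data.List.Relation.Binary.Permutation.Propositional using (_↭_; ↭-sym; ↭-trans; ↭-reflexive)
open import Data.List.Relation.Binary.Permutation.Propositional.Properties using (shift; ++-comm)
open import Data.List.Relation.Unary.All as All using (All; []; _∷_)
open import Data.List.Relation.Unary.All.Properties using (applyUpTo⁺₁; all-filter; ++⁺; ++⁻ˡ)
open import Data.Nat using (ℕ; zero; suc; _+_; _∸_; _⊓_; _≤_; _<_; z≤n; s≤s; s≤s⁻¹; z<s; s<s; _<?_; _≤?_)
open import Data.Nat.Properties
open import Data.Product as Product using (_×_; ∃; _,_; proj₁; proj₂)
open import Data.Sum as Sum using (_⊎_; inj₁; inj₂)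
open import Data.Vec using (Vec; []; _∷_; _∷ʳ_; lookup; last; initLast)
open import Data.Vec.Properties using (last-∷ʳ)
open import Function using (_∘_; case_of_; _⇔_; mk⇔; Equivalence)
open import Relation.Binary.Definitions using (tri<; tri≈; tri>)
open import Relation.Binary.PropositionalEquality using (_≡_; refl; sym; trans; cong; cong₂; subst; subst₂; module ≡-Reasoning)
open import Relation.Nullary using (¬_; yes; no)
open import Relation.Unary using (Pred; Decidable)

open Equivalence using (to; from)
open ≡-Reasoning

<-gap : ∀ {m n} → m < n → n ≡ m + suc (n ∸ suc m)
<-gap {m} {n} m<n = sym (trans (+-suc m (n ∸ suc m)) (m+[n∸m]≡n m<n))

range : ℕ → ℕ → List ℕ
range s = applyUpTo (s +_)

applyUpTo-cong : ∀ {A : Set} {f g : ℕ → A} n → (∀ {i} → i < n → f i ≡ g i) → applyUpTo f n ≡ applyUpTo g n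
applyUpTo-cong zero    f≡g = refl
applyUpTo-cong (suc n) f≡g = cong₂ _∷_ (f≡g z<s) (applyUpTo-cong n (f≡g ∘ s<s))

applyUpTo-+ : ∀ {A : Set} (f : ℕ → A) m n → applyUpTo f (m + n) ≡ applyUpTo f m ++ applyUpTo (f ∘ (m +_)) n
applyUpTo-+ f zero    n = refl
applyUpTo-+ f (suc m) n = cong (f 0 ∷_) (applyUpTo-+ (f ∘ suc) m n)

range-++ : ∀ s m n → range s (m + n) ≡ range s m ++ range (s + m) n
range-++ s m n = trans (applyUpTo-+ (s +_) m n)
  (cong (range s m ++_) (applyUpTo-cong n λ {i} _ → sym (+-assoc s m i)))

map-range : ∀ {A : Set} (f φ : ℕ → A) s n → (∀ {i} → i < n → f (s + i) ≡ φ i) →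
  map f (range s n) ≡ applyUpTo φ n
map-range f φ s n f≡φ = trans (map-applyUpTo (s +_) f n) (applyUpTo-cong n f≡φ)

map-const-local : ∀ {A B : Set} {f : A → B} {c xs} → All (λ x → f x ≡ c) xs →
  map f xs ≡ replicate (length xs) c
map-const-local []         = refl
map-const-local (fx≡c ∷ p) = cong₂ _∷_ fx≡c (map-const-local p)

length≡above+atMost : ∀ l xs → length xs ≡ length (filter (l <?_) xs) + length (filter (_≤? l) xs)
length≡above+atMost l [] = refl
length≡above+atMost l (k ∷ xs) with <-≤-connex l k
... | inj₁ l<k rewrite filter-accept (l <?_) {xs = xs} l<k | filter-reject (_≤? l) {xs = xs} (<⇒≱ l<k) =
  cong suc (length≡above+atMost l xs)
... | inj₂ k≤l rewrite filter-reject (l <?_) {xs = xs} (≤⇒≯ k≤l) | filter-accept (_≤? l) {xs = xs} k≤l =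
  trans (cong suc (length≡above+atMost l xs)) (sym (+-suc _ _))

aboveAtMost : ℕ → List ℕ → ℕ × ℕ
aboveAtMost l xs = length (filter (l <?_) xs) , length (filter (_≤? l) xs)

aboveAtMost-++-∷ : ∀ l ys {y} zs → All (_≤ l) ys → y ≤ l → All (l <_) zs →
  aboveAtMost l (ys ++ y ∷ zs) ≡ (length zs , suc (length ys))
aboveAtMost-++-∷ l ys {y} zs ys≤l y≤l l<zs = cong₂ _,_ (cong length above) (begin
  length (filter (_≤? l) (ys ++ y ∷ zs)) ≡⟨ cong length atMost ⟩
  length (ys ++ y ∷ [])                  ≡⟨ length-++ ys ⟩
  length ys + 1                          ≡⟨ +-comm (length ys) 1 ⟩
  suc (length ys)                        ∎)
  where
  above : filter (l <?_) (ys ++ y ∷ zs) ≡ zs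
  above = begin
    filter (l <?_) (ys ++ y ∷ zs)
      ≡⟨ filter-++ (l <?_) ys (y ∷ zs) ⟩
    filter (l <?_) ys ++ filter (l <?_) (y ∷ zs)
      ≡⟨ cong₂ _++_ (filter-none (l <?_) (All.map ≤⇒≯ ys≤l)) (filter-reject (l <?_) (≤⇒≯ y≤l)) ⟩
    filter (l <?_) zs
      ≡⟨ filter-all (l <?_) l<zs ⟩
    zs ∎
  atMost : filter (_≤? l) (ys ++ y ∷ zs) ≡ ys ++ y ∷ []
  atMost = begin
    filter (_≤? l) (ys ++ y ∷ zs)
      ≡⟨ filter-++ (_≤? l) ys (y ∷ zs) ⟩
    filter (_≤? l) ys ++ filter (_≤? l) (y ∷ zs)
      ≡⟨ cong₂ _++_ (filter-all (_≤? l) ys≤l) (filter-accept (_≤? l) y≤l) ⟩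
    ys ++ y ∷ filter (_≤? l) zs
      ≡⟨ cong (λ zs′ → ys ++ y ∷ zs′) (filter-none (_≤? l) (All.map <⇒≱ l<zs)) ⟩
    ys ++ y ∷ [] ∎

-- The interval [x + a, x + a + c), preceded by x unless a = 0.
pointRange : ℕ → ℕ → ℕ → List ℕ
pointRange x a c = range x (1 ⊓ a) ++ range (x + a) c

length-pointRange : ∀ x a c → length (pointRange x a c) ≡ 1 ⊓ a + c
length-pointRange x a c = trans (length-++ (range x (1 ⊓ a)))
  (cong₂ _+_ (length-applyUpTo (x +_) (1 ⊓ a)) (length-applyUpTo (x + a +_) c))

pointRange-< : ∀ x a c → All (_< x + a + c) (pointRange x a c)
pointRange-< x a c = ++⁺
  (applyUpTo⁺₁ _ (1 ⊓ a) λ i<1⊓a →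
    <-≤-trans (+-monoʳ-< x (<-≤-trans i<1⊓a (m⊓n≤n 1 a))) (m≤m+n (x + a) c))
  (applyUpTo⁺₁ _ c (+-monoʳ-< (x + a)))

pointRange-++ : ∀ x a b c → pointRange x a (b + c) ≡ pointRange x a b ++ range (x + a + b) c
pointRange-++ x a b c = trans (cong (range x (1 ⊓ a) ++_) (range-++ (x + a) b c))
  (sym (++-assoc (range x (1 ⊓ a)) (range (x + a) b) (range (x + a + b) c)))

filter-upTo : ∀ {ℓ} {P : Pred ℕ ℓ} (P? : Decidable P) {N} x a c → N ≡ x + a + c →
  (∀ w → P w ⇔ (w < N × ((x + a ≤ w) ⊎ (w ≡ x)))) →
  filter P? (upTo N) ≡ pointRange x a c
filter-upTo P? x a c refl P⇔ = begin
  filter P? (range 0 (x + a + c))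
    ≡⟨ cong (filter P?) (trans (range-++ 0 (x + a) c) (cong (_++ range (x + a) c) (range-++ 0 x a))) ⟩
  filter P? ((range 0 x ++ range x a) ++ range (x + a) c)
    ≡⟨ trans (filter-++ P? (range 0 x ++ range x a) (range (x + a) c))
             (cong (_++ filter P? (range (x + a) c)) (filter-++ P? (range 0 x) (range x a))) ⟩
  (filter P? (range 0 x) ++ filter P? (range x a)) ++ filter P? (range (x + a) c)
    ≡⟨ cong₂ (λ ys zs → (ys ++ filter P? (range x a)) ++ zs) below above ⟩
  filter P? (range x a) ++ range (x + a) c
    ≡⟨ cong (_++ range (x + a) c) (gap a refl) ⟩
  range x (1 ⊓ a) ++ range (x + a) c ∎
  where
  below : filter P? (range 0 x) ≡ []
  below = filter-none P? (applyUpTo⁺₁ _ x λ {i} i<x Pi → case proj₂ (to (P⇔ i) Pi) of λ where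
    (inj₁ x+a≤i) → <⇒≱ i<x (≤-trans (m≤m+n x a) x+a≤i)
    (inj₂ refl)  → <-irrefl refl i<x)
  above : filter P? (range (x + a) c) ≡ range (x + a) c
  above = filter-all P? (applyUpTo⁺₁ _ c λ {i} i<c →
    from (P⇔ _) (+-monoʳ-< (x + a) i<c , inj₁ (m≤m+n (x + a) i)))
  gap : ∀ a′ → a′ ≡ a → filter P? (range x a′) ≡ range x (1 ⊓ a′)
  gap zero      _    = refl
  gap (suc a′) refl = trans
    (filter-accept P? (from (P⇔ (x + 0)) (≤-trans (+-monoʳ-< x z<s) (m≤m+n _ c) , inj₂ (+-identityʳ x))))
    (cong (x + 0 ∷_) (filter-none P? (applyUpTo⁺₁ _ a′ λ {i} i<a′ Pi → case proj₂ (to (P⇔ _) Pi) of λ where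
      (inj₁ x+a≤) → <⇒≱ (+-monoʳ-< x (s<s i<a′)) x+a≤
      (inj₂ eq)   → m+1+n≢m x eq)))

↭-rotate : ∀ {A : Set} (xs : List A) y ys → xs ++ y ∷ ys ↭ ys ++ y ∷ xs
↭-rotate xs y ys = ↭-trans (++-comm xs (y ∷ ys)) (↭-sym (shift y ys xs))

lookup-∷ʳ-inject₁ : ∀ {n} (e : Vec ℕ n) w i → lookup (e ∷ʳ w) (inject₁ i) ≡ lookup e i
lookup-∷ʳ-inject₁ (_ ∷ e) w F.zero    = refl
lookup-∷ʳ-inject₁ (_ ∷ e) w (F.suc i) = lookup-∷ʳ-inject₁ e w i

lookup-∷ʳ-fromℕ : ∀ {n} (e : Vec ℕ n) w → lookup (e ∷ʳ w) (fromℕ n) ≡ w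
lookup-∷ʳ-fromℕ []      w = refl
lookup-∷ʳ-fromℕ (_ ∷ e) w = lookup-∷ʳ-fromℕ e w

data SnocView {n} : Fin (suc n) → Set where
  earlier : (i : Fin n) → SnocView (inject₁ i)
  final   : SnocView (fromℕ n)

snocView : ∀ {n} (i : Fin (suc n)) → SnocView i
snocView {zero}  F.zero    = final
snocView {suc n} F.zero    = earlier F.zero
snocView {suc n} (F.suc i) with snocView i
... | earlier j = earlier (F.suc j)
... | final     = final

¬fromℕ< : ∀ {n} (i : Fin (suc n)) → ¬ (fromℕ n F.< i)
¬fromℕ< {n} i lt = <⇒≱ (subst (_< toℕ i) (toℕ-fromℕ n) lt) (s≤s⁻¹ (toℕ<n i))

-- Patterns 201 and 210

Forbidden : ℕ → ℕ → ℕ → Set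
Forbidden a b c = ((b < c) × (c < a)) ⊎ ((c < b) × (b < a))

Avoids : ℕ → ℕ → ℕ → Set
Avoids a b w = (a ≤ w) ⊎ (w ≡ b)

Compatible : ∀ {n} → Vec ℕ n → ℕ → Set
Compatible e w = ∀ i j → i F.< j → lookup e j < lookup e i → Avoids (lookup e i) (lookup e j) w

Forbidden⇒< : ∀ {a b c} → Forbidden a b c → b < a
Forbidden⇒< (inj₁ (b<c , c<a)) = <-trans b<c c<a
Forbidden⇒< (inj₂ (_ , b<a))   = b<a

Avoids⇒¬Forbidden : ∀ {a b w} → Avoids a b w → ¬ Forbidden a b w
Avoids⇒¬Forbidden (inj₁ a≤w)  (inj₁ (_ , w<a))   = <⇒≱ w<a a≤w
Avoids⇒¬Forbidden (inj₁ a≤w)  (inj₂ (w<b , b<a)) = <⇒≱ (<-trans w<b b<a) a≤w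
Avoids⇒¬Forbidden (inj₂ refl) (inj₁ (w<w , _))   = <-irrefl refl w<w
Avoids⇒¬Forbidden (inj₂ refl) (inj₂ (w<w , _))   = <-irrefl refl w<w

¬Forbidden⇒Avoids : ∀ {a b} w → b < a → ¬ Forbidden a b w → Avoids a b w
¬Forbidden⇒Avoids {a} {b} w b<a ¬f with a ≤? w
... | yes a≤w = inj₁ a≤w
... | no a≰w with <-cmp b w
...   | tri< b<w _ _ = ⊥-elim (¬f (inj₁ (b<w , ≰⇒> a≰w)))
...   | tri≈ _ b≡w _ = inj₂ (sym b≡w)
...   | tri> _ _ w<b = ⊥-elim (¬f (inj₂ (w<b , b<a)))

module _ {n} (e : Vec ℕ n) (w : ℕ) where

  occ-∷ʳ-inject₁ : ∀ i j k → Occ (e ∷ʳ w) (inject₁ i) (inject₁ j) (inject₁ k) ⇔ Occ e i j k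
  occ-∷ʳ-inject₁ i j k rewrite toℕ-inject₁ i | toℕ-inject₁ j | toℕ-inject₁ k
    | lookup-∷ʳ-inject₁ e w i | lookup-∷ʳ-inject₁ e w j | lookup-∷ʳ-inject₁ e w k =
    mk⇔ (λ o → o) (λ o → o)

  occ-∷ʳ-fromℕ : ∀ i j →
    Occ (e ∷ʳ w) (inject₁ i) (inject₁ j) (fromℕ n) ⇔ (i F.< j × Forbidden (lookup e i) (lookup e j) w)
  occ-∷ʳ-fromℕ i j rewrite toℕ-inject₁ i | toℕ-inject₁ j | toℕ-fromℕ n
    | lookup-∷ʳ-inject₁ e w i | lookup-∷ʳ-inject₁ e w j | lookup-∷ʳ-fromℕ e w =
    mk⇔ (λ (i<j , _ , f) → i<j , f) (λ (i<j , f) → i<j , toℕ<n j , f)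

  InI-∷ʳ⇔ : InI (e ∷ʳ w) ⇔ (InI e × w ≤ n × Compatible e w)
  InI-∷ʳ⇔ = mk⇔ split join
    where
    split : InI (e ∷ʳ w) → InI e × w ≤ n × Compatible e w
    split (inv , noOcc) = (inv′ , noOcc′) , w≤n , compatible
      where
      inv′ : IsInv e
      inv′ i = subst₂ _≤_ (lookup-∷ʳ-inject₁ e w i) (toℕ-inject₁ i) (inv (inject₁ i))
      w≤n : w ≤ n
      w≤n = subst₂ _≤_ (lookup-∷ʳ-fromℕ e w) (toℕ-fromℕ n) (inv (fromℕ n))
      noOcc′ : ¬ ∃ λ i → ∃ λ j → ∃ λ k → Occ e i j k
      noOcc′ (i , j , k , o) = noOcc (inject₁ i , inject₁ j , inject₁ k , from (occ-∷ʳ-inject₁ i j k) o)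
      compatible : Compatible e w
      compatible i j i<j ej<ei = ¬Forbidden⇒Avoids w ej<ei λ f →
        noOcc (inject₁ i , inject₁ j , fromℕ n , from (occ-∷ʳ-fromℕ i j) (i<j , f))
    join : InI e × w ≤ n × Compatible e w → InI (e ∷ʳ w)
    join ((inv , noOcc) , w≤n , compatible) = inv′ , noOcc′
      where
      inv′ : IsInv (e ∷ʳ w)
      inv′ i with snocView i
      ... | earlier i′ rewrite lookup-∷ʳ-inject₁ e w i′ | toℕ-inject₁ i′ = inv i′
      ... | final rewrite lookup-∷ʳ-fromℕ e w | toℕ-fromℕ n = w≤n
      noOcc′ : ¬ ∃ λ i → ∃ λ j → ∃ λ k → Occ (e ∷ʳ w) i j k
      noOcc′ (i , j , k , o@(i<j , j<k , _)) with snocView i | snocView j | snocView k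
      ... | final     | _         | _          = ¬fromℕ< j i<j
      ... | earlier _ | final     | _          = ¬fromℕ< k j<k
      ... | earlier i′ | earlier j′ | earlier k′ = noOcc (i′ , j′ , k′ , to (occ-∷ʳ-inject₁ i′ j′ k′) o)
      ... | earlier i′ | earlier j′ | final =
        let (i′<j′ , f) = to (occ-∷ʳ-fromℕ i′ j′) o
        in Avoids⇒¬Forbidden (compatible i′ j′ i′<j′ (Forbidden⇒< f)) f

module _ {n} (e : Vec ℕ n) (v w : ℕ) where

  Compatible-∷ʳ⇔ :
    Compatible (e ∷ʳ v) w ⇔ (Compatible e w × (∀ i → v < lookup e i → Avoids (lookup e i) v w))
  Compatible-∷ʳ⇔ = mk⇔ split join
    where
    split : Compatible (e ∷ʳ v) w → Compatible e w × (∀ i → v < lookup e i → Avoids (lookup e i) v w)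
    split c = c-earlier , c-final
      where
      c-earlier : Compatible e w
      c-earlier i j i<j ej<ei
        with c (inject₁ i) (inject₁ j)
               (subst₂ _<_ (sym (toℕ-inject₁ i)) (sym (toℕ-inject₁ j)) i<j)
               (subst₂ _<_ (sym (lookup-∷ʳ-inject₁ e v j)) (sym (lookup-∷ʳ-inject₁ e v i)) ej<ei)
      ... | avoids rewrite lookup-∷ʳ-inject₁ e v i | lookup-∷ʳ-inject₁ e v j = avoids
      c-final : ∀ i → v < lookup e i → Avoids (lookup e i) v w
      c-final i v<ei
        with c (inject₁ i) (fromℕ n)
               (subst₂ _<_ (sym (toℕ-inject₁ i)) (sym (toℕ-fromℕ n)) (toℕ<n i))
               (subst₂ _<_ (sym (lookup-∷ʳ-fromℕ e v)) (sym (lookup-∷ʳ-inject₁ e v i)) v<ei)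
      ... | avoids rewrite lookup-∷ʳ-inject₁ e v i | lookup-∷ʳ-fromℕ e v = avoids
    join : Compatible e w × (∀ i → v < lookup e i → Avoids (lookup e i) v w) → Compatible (e ∷ʳ v) w
    join (c , c-final) i j i<j ej<ei with snocView i | snocView j
    ... | final      | _ = ⊥-elim (¬fromℕ< j i<j)
    ... | earlier i′ | final rewrite lookup-∷ʳ-inject₁ e v i′ | lookup-∷ʳ-fromℕ e v = c-final i′ ej<ei
    ... | earlier i′ | earlier j′ rewrite lookup-∷ʳ-inject₁ e v i′ | lookup-∷ʳ-inject₁ e v j′ =
      c i′ j′ (subst₂ _<_ (toℕ-inject₁ i′) (toℕ-inject₁ j′) i<j) ej<ei

lookup-∷ʳ-≤ : ∀ {n K w} (e : Vec ℕ n) → (∀ i → lookup e i ≤ K) → w ≤ K → ∀ i → lookup (e ∷ʳ w) i ≤ K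
lookup-∷ʳ-≤ {w = w} e e≤K w≤K i with snocView i
... | earlier i′ rewrite lookup-∷ʳ-inject₁ e w i′ = e≤K i′
... | final      rewrite lookup-∷ʳ-fromℕ e w = w≤K

data LastShape (l M t x : ℕ) : Set where
  atMax    : l ≡ M → LastShape l M t x
  belowMax : l ≡ x → x < M → t ≡ M → LastShape l M t x

record Frame (m : ℕ) (e : Vec ℕ (suc m)) (M t x : ℕ) : Set where
  field
    inI         : InI e
    x≤t         : x ≤ t
    t≤M         : t ≤ M
    M≤m         : M ≤ m
    ≤M          : ∀ i → lookup e i ≤ M
    M-attained  : ∃ λ i → lookup e i ≡ M
    compatible⇔ : ∀ w → Compatible e w ⇔ ((t ≤ w) ⊎ (w ≡ x))
    lastShape   : LastShape (last e) M t x
open Frame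

module _ {m e M t x} (F : Frame m e M t x) where

  extension⇔ : ∀ w → InI (e ∷ʳ w) ⇔ (w ≤ suc m × ((t ≤ w) ⊎ (w ≡ x)))
  extension⇔ w = mk⇔
    (λ ext → let (_ , w≤ , c) = to (InI-∷ʳ⇔ e w) ext in w≤ , to (compatible⇔ F w) c)
    (λ (w≤ , h) → from (InI-∷ʳ⇔ e w) (inI F , w≤ , from (compatible⇔ F w) h))

  Frame-∷ʳ-≥ : ∀ {v} → InI (e ∷ʳ v) → M ≤ v → Frame (suc m) (e ∷ʳ v) v t x
  Frame-∷ʳ-≥ {v} ext M≤v = record
    { inI         = ext
    ; x≤t         = x≤t F
    ; t≤M         = ≤-trans (t≤M F) M≤v
    ; M≤m         = proj₁ (proj₂ (to (InI-∷ʳ⇔ e v) ext))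
    ; ≤M          = lookup-∷ʳ-≤ e (λ i → ≤-trans (≤M F i) M≤v) ≤-refl
    ; M-attained  = fromℕ (suc m) , lookup-∷ʳ-fromℕ e v
    ; compatible⇔ = λ w → mk⇔
        (λ c → to (compatible⇔ F w) (proj₁ (to (Compatible-∷ʳ⇔ e v w) c)))
        (λ h → from (Compatible-∷ʳ⇔ e v w)
          (from (compatible⇔ F w) h , λ i v<ei → ⊥-elim (<⇒≱ v<ei (≤-trans (≤M F i) M≤v))))
    ; lastShape   = atMax (last-∷ʳ v e)
    }

  Frame-∷ʳ-< : ∀ {v} → InI (e ∷ʳ v) → v < M → Frame (suc m) (e ∷ʳ v) M M v
  Frame-∷ʳ-< {v} ext v<M = record
    { inI         = ext
    ; x≤t         = <⇒≤ v<M
    ; t≤M         = ≤-refl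
    ; M≤m         = m≤n⇒m≤1+n (M≤m F)
    ; ≤M          = lookup-∷ʳ-≤ e (≤M F) (<⇒≤ v<M)
    ; M-attained  = let (i , ei≡M) = M-attained F in inject₁ i , trans (lookup-∷ʳ-inject₁ e v i) ei≡M
    ; compatible⇔ = λ w → mk⇔ (avoids-max w) (compatible w)
    ; lastShape   = belowMax (last-∷ʳ v e) v<M refl
    }
    where
    avoids-max : ∀ w → Compatible (e ∷ʳ v) w → (M ≤ w) ⊎ (w ≡ v)
    avoids-max w c =
      let (i , ei≡M) = M-attained F
      in Sum.map₁ (subst (_≤ w) ei≡M) (proj₂ (to (Compatible-∷ʳ⇔ e v w) c) i (subst (v <_) (sym ei≡M) v<M))
    compatible : ∀ w → (M ≤ w) ⊎ (w ≡ v) → Compatible (e ∷ʳ v) w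
    compatible w (inj₁ M≤w) = from (Compatible-∷ʳ⇔ e v w)
      (from (compatible⇔ F w) (inj₁ (≤-trans (t≤M F) M≤w)) , λ i _ → inj₁ (≤-trans (≤M F i) M≤w))
    compatible w (inj₂ refl) = from (Compatible-∷ʳ⇔ e v v)
      (proj₂ (proj₂ (to (InI-∷ʳ⇔ e v) ext)) , λ i _ → inj₂ refl)

Frame-singleton : ∀ {a} → InI (a ∷ []) → Frame 0 (a ∷ []) 0 0 0
Frame-singleton ia@(inv , _) with n≤0⇒n≡0 (inv F.zero)
... | refl = record
  { inI         = ia
  ; x≤t         = z≤n
  ; t≤M         = z≤n
  ; M≤m         = z≤n
  ; ≤M          = λ { F.zero → z≤n }
  ; M-attained  = F.zero , refl
  ; compatible⇔ = λ w → mk⇔ (λ _ → inj₁ z≤n) (λ _ → λ { F.zero F.zero () _ })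
  ; lastShape   = atMax refl
  }

frame : ∀ m (e : Vec ℕ (suc m)) → InI e → ∃ λ M → ∃ λ t → ∃ λ x → Frame m e M t x
frame zero    (a ∷ []) ia = 0 , 0 , 0 , Frame-singleton ia
frame (suc m) e        ie with initLast e
... | e′ , v , refl with frame m e′ (proj₁ (to (InI-∷ʳ⇔ e′ v) ie))
...   | M , t , x , F with M ≤? v
...     | yes M≤v = v , t , x , Frame-∷ʳ-≥ F ie M≤v
...     | no  M≰v = M , M , v , Frame-∷ʳ-< F ie (≰⇒> M≰v)

-- Extensions and parameters

module _ {m e M t x} (F : Frame m e M t x) where

  extensions-≡ : ∀ {a b d} → t ≡ x + a → M ≡ t + b → m ≡ M + d →
    extensions e ≡ pointRange x a b ++ range M (2 + d)
  extensions-≡ {a} {b} {d} refl refl refl = trans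
    (filter-upTo (λ k → InI? (e ∷ʳ k)) x a (b + (2 + d)) size ext⇔)
    (pointRange-++ x a b (2 + d))
    where
    size : 2 + m ≡ x + a + (b + (2 + d))
    size = begin
      2 + (M + d)           ≡⟨ cong suc (sym (+-suc M d)) ⟩
      1 + (M + suc d)       ≡⟨ sym (+-suc M (suc d)) ⟩
      M + (2 + d)           ≡⟨ +-assoc (x + a) b (2 + d) ⟩
      x + a + (b + (2 + d)) ∎
    ext⇔ : ∀ w → InI (e ∷ʳ w) ⇔ (w < 2 + m × ((x + a ≤ w) ⊎ (w ≡ x)))
    ext⇔ w = mk⇔ (Product.map₁ s≤s ∘ to (extension⇔ F w)) (from (extension⇔ F w) ∘ Product.map₁ s≤s⁻¹)

  params-atMax : ∀ {a b d} → last e ≡ M → t ≡ x + a → M ≡ t + b → m ≡ M + d →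
    params e ≡ (suc d , suc (1 ⊓ a + b))
  params-atMax {a} {b} {d} le refl refl refl = begin
    aboveAtMost (last e) (extensions e)
      ≡⟨ cong₂ aboveAtMost le (extensions-≡ refl refl refl) ⟩
    aboveAtMost M (pointRange x a b ++ M + 0 ∷ applyUpTo (λ i → M + suc i) (suc d))
      ≡⟨ aboveAtMost-++-∷ M (pointRange x a b) (applyUpTo (λ i → M + suc i) (suc d))
           (All.map <⇒≤ (pointRange-< x a b)) (≤-reflexive (+-identityʳ M))
           (applyUpTo⁺₁ _ (suc d) λ {i} _ → m<m+n M {suc i} z<s) ⟩
    (length (applyUpTo (λ i → M + suc i) (suc d)) , suc (length (pointRange x a b)))
      ≡⟨ cong₂ (λ p q → p , suc q) (length-applyUpTo (λ i → M + suc i) (suc d)) (length-pointRange x a b) ⟩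
    (suc d , suc (1 ⊓ a + b)) ∎

  params-belowMax : ∀ {d} → last e ≡ x → x < M → t ≡ M → m ≡ M + d → params e ≡ (2 + d , 1)
  params-belowMax {d} le x<M refl refl = begin
    aboveAtMost (last e) (extensions e)
      ≡⟨ cong₂ aboveAtMost le (extensions-≡ (<-gap x<M) (sym (+-identityʳ M)) refl) ⟩
    aboveAtMost x ([] ++ x + 0 ∷ range M (2 + d))
      ≡⟨ aboveAtMost-++-∷ x [] (range M (2 + d)) [] (≤-reflexive (+-identityʳ x))
           (applyUpTo⁺₁ (M +_) (2 + d) λ {i} _ → <-≤-trans x<M (m≤m+n M i)) ⟩
    (length (range M (2 + d)) , 1)
      ≡⟨ cong (_, 1) (length-applyUpTo (M +_) (2 + d)) ⟩
    (2 + d , 1) ∎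

  valid-extensions : All (λ k → InI (e ∷ʳ k)) (extensions e)
  valid-extensions = all-filter (λ k → InI? (e ∷ʳ k)) (upTo (2 + m))

childParams : ℕ → ℕ → List (ℕ × ℕ)
childParams p q = replicate (q ∸ 1) (p + 2 , 1) ++ (suc p , q) ∷ map (λ i → (p ∸ i , q + suc i)) (upTo p)

childParams↭expectedParams : ∀ p q → childParams p q ↭ expectedParams p q
childParams↭expectedParams p q = ↭-rotate _ _ _

-- Functions and implicit arguments around params are written out in full below: leaving them to
-- unification makes Agda unfold params, whose normal form is enormous.
module _ {m e M t x} (F : Frame m e M t x) where

  params-∷ʳ-below : ∀ {d k} → m ≡ M + d → InI (e ∷ʳ k) → k < M → params (e ∷ʳ k) ≡ (3 + d , 1)
  params-∷ʳ-below {d} {k} refl ext k<M =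
    params-belowMax (Frame-∷ʳ-< F ext k<M) (last-∷ʳ k e) k<M refl (sym (+-suc M d))

  params-∷ʳ-above : ∀ {a b d j} → t ≡ x + a → M ≡ t + b → m ≡ M + d → j ≤ suc d →
    params (e ∷ʳ (M + j)) ≡ (suc (suc d ∸ j) , suc (1 ⊓ a + (b + j)))
  params-∷ʳ-above {a} {b} {d} {j} refl refl refl j≤1+d =
    params-atMax (Frame-∷ʳ-≥ F ext (m≤m+n M j)) (last-∷ʳ (M + j) e) refl (+-assoc (x + a) b j) size
    where
    ext : InI (e ∷ʳ (M + j))
    ext = from (extension⇔ F (M + j))
      (subst (M + j ≤_) (+-suc M d) (+-monoʳ-≤ M j≤1+d) , inj₁ (≤-trans (m≤m+n (x + a) b) (m≤m+n M j)))
    size : suc (M + d) ≡ M + j + (suc d ∸ j)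
    size = begin
      suc (M + d)          ≡⟨ sym (+-suc M d) ⟩
      M + suc d            ≡⟨ cong (M +_) (sym (m+[n∸m]≡n j≤1+d)) ⟩
      M + (j + (suc d ∸ j)) ≡⟨ sym (+-assoc M j (suc d ∸ j)) ⟩
      M + j + (suc d ∸ j)  ∎

  map-params-below : ∀ {d ks} → m ≡ M + d → All (λ k → InI (e ∷ʳ k)) ks → All (_< M) ks →
    map (λ k → params (e ∷ʳ k)) ks ≡ replicate (length ks) (3 + d , 1)
  map-params-below {d} m≡ valid below = map-const-local {f = λ k → params (e ∷ʳ k)}
    (All.zipWith (λ {k} (ext , k<M) → params-∷ʳ-below {d} {k} m≡ ext k<M) (valid , below))

  map-params-range : ∀ {a b d} → t ≡ x + a → M ≡ t + b → m ≡ M + d →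
    map (λ k → params (e ∷ʳ k)) (range M (2 + d)) ≡
    applyUpTo (λ j → suc (suc d ∸ j) , suc (1 ⊓ a + (b + j))) (2 + d)
  map-params-range {a} {b} {d} t≡ M≡ m≡ =
    map-range (λ k → params (e ∷ʳ k)) (λ j → suc (suc d ∸ j) , suc (1 ⊓ a + (b + j))) M (2 + d)
      (λ {j} j<2+d → params-∷ʳ-above {a} {b} {d} {j} t≡ M≡ m≡ (s≤s⁻¹ j<2+d))

  map-params-atMax : ∀ {a b d} → last e ≡ M → t ≡ x + a → M ≡ t + b → m ≡ M + d →
    map (λ k → params (e ∷ʳ k)) (extensions e) ≡ childParams (suc d) (suc (1 ⊓ a + b))
  map-params-atMax {a} {b} {d} le refl refl refl = begin
    map (λ k → params (e ∷ʳ k)) (extensions e)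
      ≡⟨ cong (map (λ k → params (e ∷ʳ k))) split ⟩
    map (λ k → params (e ∷ʳ k)) (pointRange x a b ++ range M (2 + d))
      ≡⟨ map-++ (λ k → params (e ∷ʳ k)) (pointRange x a b) (range M (2 + d)) ⟩
    map (λ k → params (e ∷ʳ k)) (pointRange x a b) ++ map (λ k → params (e ∷ʳ k)) (range M (2 + d))
      ≡⟨ cong₂ _++_ (map-params-below {d} refl valid-lows (pointRange-< x a b))
                    (map-params-range {a} {b} {d} refl refl refl) ⟩
    replicate (length (pointRange x a b)) (3 + d , 1) ++ applyUpTo (λ j → suc (suc d ∸ j) , q j) (2 + d)
      ≡⟨ cong₂ _++_ (cong₂ replicate (length-pointRange x a b) (cong (λ n → suc n , 1) (+-comm 2 d))) highs ⟩
    childParams (suc d) (suc (1 ⊓ a + b)) ∎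
    where
    q : ℕ → ℕ
    q j = suc (1 ⊓ a + (b + j))
    split : extensions e ≡ pointRange x a b ++ range M (2 + d)
    split = extensions-≡ F refl refl refl
    valid-lows : All (λ k → InI (e ∷ʳ k)) (pointRange x a b)
    valid-lows = ++⁻ˡ (pointRange x a b) (subst (All (λ k → InI (e ∷ʳ k))) split (valid-extensions F))
    h : ℕ → ℕ × ℕ
    h i = suc d ∸ i , suc (1 ⊓ a + b) + suc i
    highs : applyUpTo (λ j → suc (suc d ∸ j) , q j) (2 + d) ≡
            (suc (suc d) , suc (1 ⊓ a + b)) ∷ map h (upTo (suc d))
    highs = cong₂ _∷_ (cong (λ n → suc (suc d) , suc (1 ⊓ a + n)) (+-identityʳ b)) (begin
      applyUpTo (λ i → suc (d ∸ i) , q (suc i)) (suc d)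
        ≡⟨ applyUpTo-cong {f = λ i → suc (d ∸ i) , q (suc i)} {g = h} (suc d) (λ {i} i<1+d →
             cong₂ _,_ (sym (+-∸-assoc 1 (s≤s⁻¹ i<1+d))) (cong suc (sym (+-assoc (1 ⊓ a) b (suc i))))) ⟩
      applyUpTo h (suc d)
        ≡⟨ sym (map-upTo h (suc d)) ⟩
      map h (upTo (suc d)) ∎)

  map-params-belowMax : ∀ {d} → last e ≡ x → x < M → t ≡ M → m ≡ M + d →
    map (λ k → params (e ∷ʳ k)) (extensions e) ≡ childParams (2 + d) 1
  map-params-belowMax {d} le x<M refl refl = begin
    map (λ k → params (e ∷ʳ k)) (extensions e)
      ≡⟨ cong (map (λ k → params (e ∷ʳ k))) split ⟩
    map (λ k → params (e ∷ʳ k)) (x + 0 ∷ range M (2 + d))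
      ≡⟨ cong₂ _∷_ (params-∷ʳ-below {d} {x + 0} refl valid-x (subst (_< M) (sym (+-identityʳ x)) x<M))
                   (map-params-range {suc (M ∸ suc x)} {0} {d} (<-gap x<M) (sym (+-identityʳ M)) refl) ⟩
    (3 + d , 1) ∷ applyUpTo (λ j → suc (suc d ∸ j) , 2 + j) (2 + d)
      ≡⟨ cong ((3 + d , 1) ∷_) highs ⟩
    childParams (2 + d) 1 ∎
    where
    split : extensions e ≡ x + 0 ∷ range M (2 + d)
    split = extensions-≡ F {suc (M ∸ suc x)} {0} {d} (<-gap x<M) (sym (+-identityʳ M)) refl
    valid-x : InI (e ∷ʳ (x + 0))
    valid-x = All.head (subst (All (λ k → InI (e ∷ʳ k))) split (valid-extensions F))
    h : ℕ → ℕ × ℕ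
    h j = 2 + d ∸ j , 1 + suc j
    highs : applyUpTo (λ j → suc (suc d ∸ j) , 2 + j) (2 + d) ≡ map h (upTo (2 + d))
    highs = begin
      applyUpTo (λ j → suc (suc d ∸ j) , 2 + j) (2 + d)
        ≡⟨ applyUpTo-cong {f = λ j → suc (suc d ∸ j) , 2 + j} {g = h} (2 + d) (λ {j} j<2+d →
             cong (_, 2 + j) (sym (+-∸-assoc 1 (s≤s⁻¹ j<2+d)))) ⟩
      applyUpTo h (2 + d)
        ≡⟨ sym (map-upTo h (2 + d)) ⟩
      map h (upTo (2 + d)) ∎

-- Matching on refl instantiates p and q by paramP e and paramQ e without unfolding them.
transport-params : ∀ {ℓ m} {e : Vec ℕ (suc m)} (P : ℕ → ℕ → Set ℓ) {p q} →
  params e ≡ (p , q) → P p q → P (paramP e) (paramQ e)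
transport-params P refl Ppq = Ppq

map-params-extensions : ∀ {m e M t x} → Frame m e M t x →
  map (λ k → params (e ∷ʳ k)) (extensions e) ≡ childParams (paramP e) (paramQ e)
map-params-extensions {m} {e} {M} {t} {x} F = byShape (lastShape F)
  where
  ChildParams : ℕ → ℕ → Set
  ChildParams p q = map (λ k → params (e ∷ʳ k)) (extensions e) ≡ childParams p q
  x+ : t ≡ x + (t ∸ x)
  x+ = sym (m+[n∸m]≡n (x≤t F))
  t+ : M ≡ t + (M ∸ t)
  t+ = sym (m+[n∸m]≡n (t≤M F))
  M+ : m ≡ M + (m ∸ M)
  M+ = sym (m+[n∸m]≡n (M≤m F))
  byShape : LastShape (last e) M t x → ChildParams (paramP e) (paramQ e)
  byShape (atMax le) =
    transport-params {e = e} ChildParams (params-atMax F le x+ t+ M+) (map-params-atMax F le x+ t+ M+)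
  byShape (belowMax le x<M t≡M) =
    transport-params {e = e} ChildParams (params-belowMax F le x<M t≡M M+) (map-params-belowMax F le x<M t≡M M+)

lemma4p5 : (m : ℕ) (e : Vec ℕ (suc m)) → InI e →
    (length (extensions e) ≡ paramP e + paramQ e) ×
    (map (λ k → params (e ∷ʳ k)) (extensions e) ↭ expectedParams (paramP e) (paramQ e))
lemma4p5 m e ie =
  let (_ , _ , _ , F) = frame m e ie in
  length≡above+atMost (last e) (extensions e) ,
  ↭-trans (↭-reflexive (map-params-extensions F)) (childParams↭expectedParams (paramP e) (paramQ e))
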